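{- For every even integer $k \geq 4$, \[ P_k(k-1) < 0, \quad\text{where } P_k(m) = 2(m-1)^{k+1} + (k+1)(m-1)^{k} - 2(k+1)m^{k} + (k-1). \]
   Context: $P_k(m)$ equals $2(k+1)\left(S_{\mathbb{R}}(m-1,k) - m^k\right)$ with $S_{\mathbb{R}}(m-1,k) = \frac{(m-1)^{k+1}-1}{k+1} + \frac{1+(m-1)^k}{2}$, so its sign is that of $S_{\mathbb{R}}(m-1,k) - m^k$. -}

module Defs where

open import Data.Nat using (ℕ)
open import Data.Integer using (ℤ; +_; _+_; _-_; _*_; _^_)

P : ℕ → ℤ → ℤ
P k m = + 2 * (m - + 1) ^ (ℕ.suc k)
      + (+ k + + 1) * (m - + 1) ^ k
      - + 2 * (+ k + + 1) * m ^ k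
      + (+ k - + 1)

{-# OPTIONS --safe #-}
module Submission where

-- Write k = a + 2, so m = k - 1 = a + 1. Then P k m = m (3a^(a+2) + 1 - 2(a+3) m^(a+1)), and
-- Bernoulli's inequality gives m^m ≥ 2a^m, hence 2(a+3) m^m ≥ 4a^(a+2) + 6 > 3a^(a+2) + 1.

open import Defs
open import Data.Nat using (ℕ; _≤_)
open import Data.Nat.Divisibility using (_∣_)
open import Data.Integer using (+_; _-_; _<_)

open import Data.Nat.Base as ℕ using (zero; suc; s≤s; z≤n)
import Data.Nat.Properties as ℕ
import Data.Nat.Tactic.RingSolver as ℕ-Ring
open import Data.Integer.Base using (+<+; 0ℤ; _+_; _*_; -_; _^_)
open import Data.Integer.Properties
  using (pos-+; pos-*; +-monoˡ-<; +-inverseʳ; *-monoˡ-<-pos; *-zeroʳ; <-≤-trans; ≤-reflexive; module ≤-Reasoning)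
import Data.Integer.Tactic.RingSolver as ℤ-Ring
open import Relation.Binary.PropositionalEquality

-- Bernoulli's inequality for 1 + 1/m, multiplied through by m^(n+1).
m^[1+n]+[1+n]*m^n≤[1+m]^[1+n] : ∀ m n → m ℕ.^ suc n ℕ.+ suc n ℕ.* m ℕ.^ n ≤ suc m ℕ.^ suc n
m^[1+n]+[1+n]*m^n≤[1+m]^[1+n] m zero = ℕ.≤-reflexive (base m)
  where
  base : ∀ m → m ℕ.* 1 ℕ.+ 1 ℕ.* 1 ≡ suc m ℕ.* 1
  base = ℕ-Ring.solve-∀
m^[1+n]+[1+n]*m^n≤[1+m]^[1+n] m (suc n) = begin
  m ℕ.^ (2 ℕ.+ n) ℕ.+ (2 ℕ.+ n) ℕ.* m ℕ.^ suc n
    ≤⟨ ℕ.m≤m+n _ (suc n ℕ.* m ℕ.^ n) ⟩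
  m ℕ.^ (2 ℕ.+ n) ℕ.+ (2 ℕ.+ n) ℕ.* m ℕ.^ suc n ℕ.+ suc n ℕ.* m ℕ.^ n
    ≡⟨ expand m n (m ℕ.^ n) ⟩
  suc m ℕ.* (m ℕ.^ suc n ℕ.+ suc n ℕ.* m ℕ.^ n)
    ≤⟨ ℕ.*-monoʳ-≤ (suc m) (m^[1+n]+[1+n]*m^n≤[1+m]^[1+n] m n) ⟩
  suc m ℕ.^ (2 ℕ.+ n) ∎
  where
  open ℕ.≤-Reasoning
  expand : ∀ m n x → m ℕ.* (m ℕ.* x) ℕ.+ (2 ℕ.+ n) ℕ.* (m ℕ.* x) ℕ.+ suc n ℕ.* x
                   ≡ suc m ℕ.* (m ℕ.* x ℕ.+ suc n ℕ.* x)
  expand = ℕ-Ring.solve-∀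

2*m^[1+m]≤[1+m]^[1+m] : ∀ m → 2 ℕ.* m ℕ.^ suc m ≤ suc m ℕ.^ suc m
2*m^[1+m]≤[1+m]^[1+m] m = begin
  2 ℕ.* m ℕ.^ suc m                  ≡⟨ cong (m ℕ.^ suc m ℕ.+_) (ℕ.+-identityʳ _) ⟩
  m ℕ.^ suc m ℕ.+ m ℕ.* m ℕ.^ m      ≤⟨ ℕ.+-monoʳ-≤ (m ℕ.^ suc m) (ℕ.*-monoˡ-≤ (m ℕ.^ m) (ℕ.n≤1+n m)) ⟩
  m ℕ.^ suc m ℕ.+ suc m ℕ.* m ℕ.^ m  ≤⟨ m^[1+n]+[1+n]*m^n≤[1+m]^[1+n] m m ⟩
  suc m ℕ.^ suc m                    ∎
  where open ℕ.≤-Reasoning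

3*m^[2+m]+1<2*[m+3]*[1+m]^[1+m] : ∀ m → 3 ℕ.* m ℕ.^ (2 ℕ.+ m) ℕ.+ 1 ℕ.< 2 ℕ.* (m ℕ.+ 3) ℕ.* suc m ℕ.^ suc m
3*m^[2+m]+1<2*[m+3]*[1+m]^[1+m] m = begin-strict
  3 ℕ.* m ℕ.^ (2 ℕ.+ m) ℕ.+ 1        ≤⟨ ℕ.+-monoˡ-≤ 1 (ℕ.*-monoˡ-≤ (m ℕ.^ (2 ℕ.+ m)) (ℕ.n≤1+n 3)) ⟩
  4 ℕ.* (m ℕ.* m ℕ.^ suc m) ℕ.+ 1    ≡⟨ cong (ℕ._+ 1) (regroup m (m ℕ.^ suc m)) ⟩
  2 ℕ.* m ℕ.* (2 ℕ.* m ℕ.^ suc m) ℕ.+ 1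
    <⟨ ℕ.+-mono-≤-< (ℕ.*-monoʳ-≤ (2 ℕ.* m) (2*m^[1+m]≤[1+m]^[1+m] m)) 1<6*B ⟩
  2 ℕ.* m ℕ.* B ℕ.+ 6 ℕ.* B          ≡⟨ collect m B ⟩
  2 ℕ.* (m ℕ.+ 3) ℕ.* B              ∎
  where
  open ℕ.≤-Reasoning
  B = suc m ℕ.^ suc m
  1<6*B : 1 ℕ.< 6 ℕ.* B
  1<6*B = ℕ.<-≤-trans (s≤s (s≤s z≤n)) (ℕ.*-monoʳ-≤ 6 (ℕ.m^n>0 (suc m) (suc m)))
  regroup : ∀ m x → 4 ℕ.* (m ℕ.* x) ≡ 2 ℕ.* m ℕ.* (2 ℕ.* x)
  regroup = ℕ-Ring.solve-∀
  collect : ∀ m b → 2 ℕ.* m ℕ.* b ℕ.+ 6 ℕ.* b ≡ 2 ℕ.* (m ℕ.+ 3) ℕ.* b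
  collect = ℕ-Ring.solve-∀

pos-^ : ∀ m n → + (m ℕ.^ n) ≡ (+ m) ^ n
pos-^ m zero    = refl
pos-^ m (suc n) = trans (pos-* m (m ℕ.^ n)) (cong (+ m *_) (pos-^ m n))

i<j⇒i-j<0 : ∀ {i j} → i < j → i - j < 0ℤ
i<j⇒i-j<0 {j = j} i<j = <-≤-trans (+-monoˡ-< (- j) i<j) (≤-reflexive (+-inverseʳ j))

-- At m = k - 1 every term of P k m is divisible by m, since 2(m - 1) + (k + 1) = 3m and k - 1 = m.
P[2+a,1+a]-factorisation : ∀ a →
  P (2 ℕ.+ a) (+ (2 ℕ.+ a) - + 1)
    ≡ + suc a * ((+ 3 * (+ a) ^ (2 ℕ.+ a) + + 1) - + 2 * (+ a + + 3) * (+ suc a) ^ suc a)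
P[2+a,1+a]-factorisation a = factor (+ a) ((+ a) ^ (2 ℕ.+ a)) ((+ suc a) ^ suc a)
  where
  factor : ∀ A x y →
    + 2 * (A * x) + ((+ 2 + A) + + 1) * x - + 2 * ((+ 2 + A) + + 1) * ((+ 1 + A) * y) + ((+ 2 + A) - + 1)
      ≡ (+ 1 + A) * ((+ 3 * x + + 1) - + 2 * (A + + 3) * y)
  factor = ℤ-Ring.solve-∀

3*a^[2+a]+1<2*[a+3]*[1+a]^[1+a]-ℤ : ∀ a →
  + 3 * (+ a) ^ (2 ℕ.+ a) + + 1 < + 2 * (+ a + + 3) * (+ suc a) ^ suc a
3*a^[2+a]+1<2*[a+3]*[1+a]^[1+a]-ℤ a =
  subst₂ _<_ cast-lhs cast-rhs (+<+ (3*m^[2+m]+1<2*[m+3]*[1+m]^[1+m] a))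
  where
  cast-lhs : + (3 ℕ.* a ℕ.^ (2 ℕ.+ a) ℕ.+ 1) ≡ + 3 * (+ a) ^ (2 ℕ.+ a) + + 1
  cast-lhs = trans (pos-+ _ 1) (cong (_+ + 1) (trans (pos-* 3 (a ℕ.^ (2 ℕ.+ a))) (cong (+ 3 *_) (pos-^ a (2 ℕ.+ a)))))
  cast-rhs : + (2 ℕ.* (a ℕ.+ 3) ℕ.* suc a ℕ.^ suc a) ≡ + 2 * (+ a + + 3) * (+ suc a) ^ suc a
  cast-rhs = trans (pos-* (2 ℕ.* (a ℕ.+ 3)) _) (cong₂ _*_ (pos-* 2 (a ℕ.+ 3)) (pos-^ (suc a) (suc a)))

P[k,k-1]<0 : ∀ k → 2 ≤ k → P k (+ k - + 1) < 0ℤ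
P[k,k-1]<0 (suc (suc a)) (s≤s (s≤s z≤n)) = begin-strict
  P (2 ℕ.+ a) (+ (2 ℕ.+ a) - + 1)
    ≡⟨ P[2+a,1+a]-factorisation a ⟩
  + suc a * ((+ 3 * (+ a) ^ (2 ℕ.+ a) + + 1) - + 2 * (+ a + + 3) * (+ suc a) ^ suc a)
    <⟨ *-monoˡ-<-pos (+ suc a) (i<j⇒i-j<0 (3*a^[2+a]+1<2*[a+3]*[1+a]^[1+a]-ℤ a)) ⟩
  + suc a * 0ℤ
    ≡⟨ *-zeroʳ (+ suc a) ⟩
  0ℤ ∎
  where open ≤-Reasoning

lemma9 : (k : ℕ) → 4 ≤ k → 2 ∣ k → P k (+ k - + 1) < + 0
lemma9 k 4≤k _ = P[k,k-1]<0 k (ℕ.≤-trans (s≤s (s≤s z≤n)) 4≤k)
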